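{- Fix $k\ge2$ and write $A_xy=A_x(k,y)$. Let $m\equiv_k A_ab$ with $k$-sandwiching sequence $(a_i,b_i)_{i=1}^n$ and sandwiching values $(m_i)_{i\le n}$, let $1\le x<k$, let $d$ be a natural number and $0\le j\le n$ be such that if $j\ge1$ then $d<a_j$. Then $A_d^xm_j$ is in normal form, i.e. $A_d^xm_j\equiv_k A_d\big(A_d^{x-1}m_j\big)$.
   Context: Ackermann function: for $k\ge 2$, $a,b\ge 0$: $A_a(k,-1):=1$, $A_0(k,b):=k^b$, $A_{a+1}(k,b):=A_a(k,\cdot)^k(A_{a+1}(k,b-1))$; $A_x^jy$ denotes the $j$-fold iterate of $y\mapsto A_xy$. $k$-normal form and sandwiching: for $m>0$, $m\equiv_k A_ab+c$ means $m=A_ab+c$ and there exist $n\ge1$ and naturals $a_1..a_n$, $b_1..b_n$, $m_0..m_n$ (sandwiching values) with $m_0=0$; for $0\le i<n$: $A_{a_{i+1}}m_i\le m<A_{a_{i+1}+1}m_i$, $A_{a_{i+1}}b_{i+1}\le m<A_{a_{i+1}}(b_{i+1}+1)$, $m_{i+1}=A_{a_{i+1}}b_{i+1}$; $A_0m_n>m$; $a=a_n$, $b=b_n$. The sequence $(a_i,b_i)_{i=1}^n$ is the $k$-sandwiching sequence of $m$ (uniquely determined by $m$). $m\equiv_k A_ab$ means $m\equiv_k A_ab+0$. -}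

module Defs where

open import Data.Nat using (ℕ; zero; suc; _+_; _^_; _≤_; _<_)
open import Data.Product using (_×_; ∃-syntax)
open import Relation.Binary.PropositionalEquality using (_≡_)

iter : (ℕ → ℕ) → ℕ → ℕ → ℕ
iter f zero    y = y
iter f (suc j) y = f (iter f j y)

-- Ackermann function  A a k b  =  A_a(k,b)  for b ≥ 0.
-- A_a(k,-1) = 1 is built in:  A_{a+1}(k,0) = A_a(k,·)^k (A_{a+1}(k,-1)) = A_a(k,·)^k 1.
A : ℕ → ℕ → ℕ → ℕ
A zero    k b       = k ^ b
A (suc a) k zero    = iter (A a k) k 1
A (suc a) k (suc b) = iter (A a k) k (A (suc a) k b)

-- (as i, bs i)_{i=1..n} is a k-sandwiching sequence of m with sandwiching
-- values (ms i)_{i=0..n}  (only indices 1..n of as, bs and 0..n of ms matter).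
IsSandwiching : (k m n : ℕ) (as bs ms : ℕ → ℕ) → Set
IsSandwiching k m n as bs ms =
  1 ≤ n × ms 0 ≡ 0 ×
  (∀ i → i < n →
      A (as (suc i)) k (ms i) ≤ m × m < A (suc (as (suc i))) k (ms i) ×
      A (as (suc i)) k (bs (suc i)) ≤ m × m < A (as (suc i)) k (suc (bs (suc i))) ×
      ms (suc i) ≡ A (as (suc i)) k (bs (suc i))) ×
  m < A 0 k (ms n)

NormalForm : (k m a b c : ℕ) → Set
NormalForm k m a b c =
  0 < m × m ≡ A a k b + c ×
  ∃[ n ] ∃[ as ] ∃[ bs ] ∃[ ms ]
    (IsSandwiching k m n as bs ms × as n ≡ a × bs n ≡ b)

module Submission where

open import Defs
open import Data.Nat
  using (ℕ; zero; suc; _+_; _^_; _∸_; _≤_; _<_; _≤′_; ≤′-reflexive; ≤′-refl; ≤′-step; z≤n; s≤s; z<s; _≟_)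
open import Data.Nat.Properties
open import Data.Product using (_×_; _,_; proj₁; proj₂; ∃-syntax)
open import Data.Sum using (inj₁; inj₂)
open import Relation.Nullary using (yes; no)
open import Relation.Nullary.Negation using (contradiction)
open import Relation.Binary.PropositionalEquality using (_≡_; _≢_; refl; sym; trans; subst)

-- The sandwiching sequence of M = A_d^x m_j is that of m cut after j steps and
-- extended by (d, A_d^(x-1) m_j).  The first j steps survive because
-- m_j ≤ M < A_{a_j}(b_j + 1), and the ceilings A_{a_i}(b_i + 1) do not increase
-- along a sandwiching sequence, so each earlier window still contains M.  The
-- new step holds because x < k gives A_d^x m_j < A_d^k m_j ≤ A_{d+1} m_j.

module _ {f : ℕ → ℕ} where

  step-≤⇒mono : (∀ y → f y ≤ f (suc y)) → ∀ {y z} → y ≤ z → f y ≤ f z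
  step-≤⇒mono step y≤z = go (≤⇒≤′ y≤z)
    where
    go : ∀ {y z} → y ≤′ z → f y ≤ f z
    go ≤′-refl     = ≤-refl
    go (≤′-step p) = ≤-trans (go p) (step _)

  step-<⇒strictMono : (∀ y → f y < f (suc y)) → ∀ {y z} → y < z → f y < f z
  step-<⇒strictMono step y<z = go (≤⇒≤′ y<z)
    where
    go : ∀ {y z} → suc y ≤′ z → f y < f z
    go ≤′-refl     = step _
    go (≤′-step p) = <-trans (go p) (step _)

module _ {f : ℕ → ℕ} where

  iter-inflationary : (∀ y → y ≤ f y) → ∀ n z → z ≤ iter f n z
  iter-inflationary infl zero    z = ≤-refl
  iter-inflationary infl (suc n) z = ≤-trans (iter-inflationary infl n z) (infl _)

  iter-monoʳ-≤ : (∀ {y z} → y ≤ z → f y ≤ f z) → ∀ n {y z} → y ≤ z → iter f n y ≤ iter f n z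
  iter-monoʳ-≤ mono zero    y≤z = y≤z
  iter-monoʳ-≤ mono (suc n) y≤z = mono (iter-monoʳ-≤ mono n y≤z)

  iter-monoˡ-≤ : (∀ y → y ≤ f y) → ∀ z {n n′} → n ≤ n′ → iter f n z ≤ iter f n′ z
  iter-monoˡ-≤ infl z = step-≤⇒mono {f = λ n → iter f n z} (λ n → infl (iter f n z))

  iter-monoˡ-< : (∀ y → y < f y) → ∀ z {n n′} → n < n′ → iter f n z < iter f n′ z
  iter-monoˡ-< infl z = step-<⇒strictMono {f = λ n → iter f n z} (λ n → infl (iter f n z))

iter-mono-≤-fun : {f g : ℕ → ℕ} → (∀ y → f y ≤ g y) → (∀ {y z} → y ≤ z → g y ≤ g z) →
                  ∀ n z → iter f n z ≤ iter g n z
iter-mono-≤-fun f≤g mono zero    z = ≤-refl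
iter-mono-≤-fun f≤g mono (suc n) z = ≤-trans (f≤g _) (mono (iter-mono-≤-fun f≤g mono n z))

iter-unfold : (f : ℕ → ℕ) {n : ℕ} → 0 < n → ∀ z → iter f n z ≡ f (iter f (n ∸ 1) z)
iter-unfold f {suc n} _ z = refl

override : (ℕ → ℕ) → ℕ → ℕ → ℕ → ℕ
override f p v i with i ≟ p
... | yes _ = v
... | no  _ = f i

override-≡ : ∀ f p v → override f p v p ≡ v
override-≡ f p v with p ≟ p
... | yes _  = refl
... | no p≢p = contradiction refl p≢p

override-≢ : ∀ f p v {i} → i ≢ p → override f p v i ≡ f i
override-≢ f p v {i} i≢p with i ≟ p
... | yes i≡p = contradiction i≡p i≢p
... | no  _   = refl

SandwichStep : (k m a mᵢ b mᵢ₊₁ : ℕ) → Set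
SandwichStep k m a mᵢ b mᵢ₊₁ =
  A a k mᵢ ≤ m × m < A (suc a) k mᵢ × A a k b ≤ m × m < A a k (suc b) × mᵢ₊₁ ≡ A a k b

SandwichStep-cong : ∀ {k m a a′ mᵢ mᵢ′ b b′ mᵢ₊₁ mᵢ₊₁′} →
  a ≡ a′ → mᵢ ≡ mᵢ′ → b ≡ b′ → mᵢ₊₁ ≡ mᵢ₊₁′ →
  SandwichStep k m a mᵢ b mᵢ₊₁ → SandwichStep k m a′ mᵢ′ b′ mᵢ₊₁′
SandwichStep-cong refl refl refl refl s = s

module Ackermann {k : ℕ} (2≤k : 2 ≤ k) where

  0<k : 0 < k
  0<k = <-trans z<s 2≤k

  n<k^n : ∀ n → n < k ^ n
  n<k^n zero    = z<s
  n<k^n (suc n) = ≤-<-trans (n<k^n n) (^-monoʳ-< k 2≤k (n<1+n n))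

  A-inflationary : ∀ a y → y < A a k y
  A-inflationary zero    y       = n<k^n y
  A-inflationary (suc a) zero    = iter-inflationary (λ y → <⇒≤ (A-inflationary a y)) k 1
  A-inflationary (suc a) (suc y) =
    ≤-<-trans (A-inflationary (suc a) y) (iter-monoˡ-< (A-inflationary a) (A (suc a) k y) 0<k)

  A-step : ∀ a y → A a k y < A a k (suc y)
  A-step zero    y = ^-monoʳ-< k 2≤k (n<1+n y)
  A-step (suc a) y = iter-monoˡ-< (A-inflationary a) (A (suc a) k y) 0<k

  A-monoʳ-≤ : ∀ a {y z} → y ≤ z → A a k y ≤ A a k z
  A-monoʳ-≤ a = step-≤⇒mono (λ y → <⇒≤ (A-step a y))

  A-cancelʳ-< : ∀ a {y z m} → A a k y ≤ m → m < A a k z → y < z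
  A-cancelʳ-< a p q = ≰⇒> (λ z≤y → <⇒≱ q (≤-trans (A-monoʳ-≤ a z≤y) p))

  A-step-level : ∀ a y → A a k y ≤ A (suc a) k y
  A-step-level a zero    =
    ≤-trans (A-monoʳ-≤ a z≤n) (iter-monoˡ-≤ (λ y → <⇒≤ (A-inflationary a y)) 1 0<k)
  A-step-level a (suc y) =
    ≤-trans (A-monoʳ-≤ a (A-inflationary (suc a) y))
            (iter-monoˡ-≤ (λ y → <⇒≤ (A-inflationary a y)) (A (suc a) k y) 0<k)

  A-monoˡ-≤ : ∀ {a a′} → a ≤ a′ → ∀ y → A a k y ≤ A a′ k y
  A-monoˡ-≤ a≤a′ y = step-≤⇒mono {f = λ a → A a k y} (λ a → A-step-level a y) a≤a′

  A-suc-in-image : ∀ a y → ∃[ w ] A (suc a) k y ≡ A a k w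
  A-suc-in-image a zero    = _ , iter-unfold (A a k) 0<k 1
  A-suc-in-image a (suc y) = _ , iter-unfold (A a k) 0<k (A (suc a) k y)

  A-in-image : ∀ {a′ a} → a′ ≤ a → ∀ y → ∃[ w ] A a k y ≡ A a′ k w
  A-in-image a′≤a = go (≤⇒≤′ a′≤a)
    where
    go : ∀ {a′ a} → a′ ≤′ a → ∀ y → ∃[ w ] A a k y ≡ A a′ k w
    go ≤′-refl     y = y , refl
    go (≤′-step p) y with A-suc-in-image _ y
    ... | w , e with go p w
    ... | w′ , e′ = w′ , trans e e′

  -- Every value of A_a is a value of A_{a′}, so it cannot fall strictly between
  -- two consecutive values of A_{a′}.
  A-next-value-≤ : ∀ {a′ a b m y} → a′ ≤ a → A a′ k b ≤ m → m < A a k y →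
                   A a′ k (suc b) ≤ A a k y
  A-next-value-≤ {a′} {b = b} {m} {y} a′≤a p q with A-in-image a′≤a y
  ... | w , e =
    subst (A a′ k (suc b) ≤_) (sym e) (A-monoʳ-≤ a′ (A-cancelʳ-< a′ p (subst (m <_) e q)))

  iter-<-next-value : ∀ {d a} x b → d < a → x < k → iter (A d k) x (A a k b) < A a k (suc b)
  iter-<-next-value {d} {suc c} x b (s≤s d≤c) x<k =
    <-≤-trans (iter-monoˡ-< (A-inflationary d) z x<k)
              (iter-mono-≤-fun (A-monoˡ-≤ d≤c) (A-monoʳ-≤ c) k z)
    where z = A (suc c) k b

  iter-<-next-level : ∀ d {x} z → x < k → iter (A d k) x z < A (suc d) k z
  iter-<-next-level d {x} zero    x<k =
    ≤-<-trans (iter-monoʳ-≤ (A-monoʳ-≤ d) x z≤n) (iter-monoˡ-< (A-inflationary d) 1 x<k)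
  iter-<-next-level d {x} (suc z) x<k =
    ≤-<-trans (iter-monoʳ-≤ (A-monoʳ-≤ d) x (A-inflationary (suc d) z))
              (iter-monoˡ-< (A-inflationary d) (A (suc d) k z) x<k)

  iterate-step : ∀ d {x} z → 0 < x → x < k →
                 SandwichStep k (iter (A d k) x z) d z (iter (A d k) (x ∸ 1) z) (iter (A d k) x z)
  iterate-step d {suc x} z _ x<k =
    A-monoʳ-≤ d (iter-inflationary (λ y → <⇒≤ (A-inflationary d y)) x z) ,
    iter-<-next-level d z x<k , ≤-refl , A-step d _ , refl

  floor≤value : ∀ a {m mᵢ b mᵢ₊₁} → SandwichStep k m a mᵢ b mᵢ₊₁ → mᵢ ≤ b
  floor≤value a (lo , _ , _ , hi , _) = ≤-pred (A-cancelʳ-< a lo hi)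

  floor≤next : ∀ a {m mᵢ b mᵢ₊₁} → SandwichStep k m a mᵢ b mᵢ₊₁ → mᵢ ≤ mᵢ₊₁
  floor≤next a s@(_ , _ , _ , _ , refl) = ≤-trans (floor≤value a s) (<⇒≤ (A-inflationary a _))

  ceiling≤next-level : ∀ a {m mᵢ b mᵢ₊₁} → SandwichStep k m a mᵢ b mᵢ₊₁ →
                       A a k (suc b) ≤ A (suc a) k mᵢ
  ceiling≤next-level a {mᵢ = mᵢ} {b} (_ , hi , lo , _ , _) =
    A-next-value-≤ {b = b} {y = mᵢ} (n≤1+n a) lo hi

  next-level≤level : ∀ a a′ {m mᵢ b mᵢ₊₁ b′ mᵢ₊₂} →
                   SandwichStep k m a mᵢ b mᵢ₊₁ → SandwichStep k m a′ mᵢ₊₁ b′ mᵢ₊₂ → a′ ≤ a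
  next-level≤level a a′ {m} {mᵢ} s@(_ , hi , _ , _ , _) (lo′ , _ , _ , _ , _) =
    ≮⇒≥ λ a<a′ → <⇒≱ hi (begin
      A (suc a) k mᵢ  ≤⟨ A-monoˡ-≤ a<a′ mᵢ ⟩
      A a′ k mᵢ       ≤⟨ A-monoʳ-≤ a′ (floor≤next a s) ⟩
      A a′ k _        ≤⟨ lo′ ⟩
      m               ∎)
    where open ≤-Reasoning

  next-ceiling≤ceiling : ∀ a a′ {m mᵢ b mᵢ₊₁ b′ mᵢ₊₂} →
                     SandwichStep k m a mᵢ b mᵢ₊₁ → SandwichStep k m a′ mᵢ₊₁ b′ mᵢ₊₂ →
                     A a′ k (suc b′) ≤ A a k (suc b)
  next-ceiling≤ceiling a a′ s@(_ , _ , _ , hi , _) s′@(_ , _ , lo′ , _ , _) =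
    A-next-value-≤ (next-level≤level a a′ s s′) lo′ hi

  extend-sandwiching : ∀ {M j a b} (as bs ms : ℕ → ℕ) → ms 0 ≡ 0 →
    (∀ i → i < j → SandwichStep k M (as (suc i)) (ms i) (bs (suc i)) (ms (suc i))) →
    SandwichStep k M a (ms j) b M →
    NormalForm k M a b 0
  extend-sandwiching {M} {j} {a} {b} as bs ms ms₀ prefix last@(lo , _ , _ , _ , M≡) =
    <-≤-trans (≤-<-trans z≤n (A-inflationary a (ms j))) lo ,
    trans M≡ (sym (+-identityʳ _)) ,
    suc j , as′ , bs′ , ms′ ,
    (s≤s z≤n ,
     trans (override-≢ ms (suc j) M (λ ())) ms₀ ,
     steps ,
     subst (λ v → M < A 0 k v) (sym (override-≡ ms (suc j) M)) (A-inflationary 0 M)) ,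
    override-≡ as (suc j) a , override-≡ bs (suc j) b
    where
    as′ bs′ ms′ : ℕ → ℕ
    as′ = override as (suc j) a
    bs′ = override bs (suc j) b
    ms′ = override ms (suc j) M

    steps : ∀ i → i < suc j → SandwichStep k M (as′ (suc i)) (ms′ i) (bs′ (suc i)) (ms′ (suc i))
    steps i i<1+j with m≤n⇒m<n∨m≡n (≤-pred i<1+j)
    ... | inj₁ i<j = SandwichStep-cong
      (sym (override-≢ as (suc j) a (<⇒≢ (s≤s i<j))))
      (sym (override-≢ ms (suc j) M (<⇒≢ i<1+j)))
      (sym (override-≢ bs (suc j) b (<⇒≢ (s≤s i<j))))
      (sym (override-≢ ms (suc j) M (<⇒≢ (s≤s i<j))))
      (prefix i i<j)
    ... | inj₂ refl = SandwichStep-cong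
      (sym (override-≡ as (suc j) a)) (sym (override-≢ ms (suc j) M (<⇒≢ (n<1+n j))))
      (sym (override-≡ bs (suc j) b)) (sym (override-≡ ms (suc j) M))
      last

  module Sandwiching {m n : ℕ} {as bs ms : ℕ → ℕ} (S : IsSandwiching k m n as bs ms) where

    ms₀ : ms 0 ≡ 0
    ms₀ = proj₁ (proj₂ S)

    step : ∀ i → i < n → SandwichStep k m (as (suc i)) (ms i) (bs (suc i)) (ms (suc i))
    step = proj₁ (proj₂ (proj₂ S))

    ceiling : ℕ → ℕ
    ceiling i = A (as i) k (suc (bs i))

    ms-mono : ∀ {i j} → i ≤ j → j ≤ n → ms i ≤ ms j
    ms-mono i≤j = go (≤⇒≤′ i≤j)
      where
      go : ∀ {i j} → i ≤′ j → j ≤ n → ms i ≤ ms j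
      go ≤′-refl     _   = ≤-refl
      go (≤′-step p) j<n = ≤-trans (go p (<⇒≤ j<n)) (floor≤next (as (suc _)) (step _ j<n))

    ceiling-antitone : ∀ {i j} → i < j → j ≤ n → ceiling j ≤ ceiling (suc i)
    ceiling-antitone i<j = go (≤⇒≤′ i<j)
      where
      go : ∀ {i j} → suc i ≤′ j → j ≤ n → ceiling j ≤ ceiling (suc i)
      go ≤′-refl _ = ≤-refl
      go {j = suc zero} (≤′-step (≤′-reflexive ())) _
      go {j = suc (suc j)} (≤′-step p) j<n =
        ≤-trans (next-ceiling≤ceiling (as (suc j)) (as (suc (suc j)))
                   (step j (<-trans (n<1+n j) j<n)) (step (suc j) j<n))
                (go p (<⇒≤ j<n))

    iter-<-ceiling : ∀ {j d x} → 0 < j → j ≤ n → d < as j → x < k →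
                     iter (A d k) x (ms j) < ceiling j
    iter-<-ceiling {suc j} {x = x} _ j<n d<aⱼ x<k with step j j<n
    ... | _ , _ , _ , _ , mⱼ≡ rewrite mⱼ≡ = iter-<-next-value x _ d<aⱼ x<k

    prefix-persists : ∀ {j M} → j ≤ n → ms j ≤ M → (0 < j → M < ceiling j) →
                      ∀ i → i < j → SandwichStep k M (as (suc i)) (ms i) (bs (suc i)) (ms (suc i))
    prefix-persists {j} {M} j≤n mⱼ≤M M<ceiling i i<j with step i (<-≤-trans i<j j≤n)
    ... | s@(_ , _ , _ , _ , mᵢ₊₁≡) =
      ≤-trans (A-monoʳ-≤ (as (suc i)) (floor≤value (as (suc i)) s)) value≤M ,
      <-≤-trans M<ceilingᵢ₊₁ (ceiling≤next-level (as (suc i)) s) ,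
      value≤M ,
      M<ceilingᵢ₊₁ ,
      mᵢ₊₁≡
      where
      value≤M : A (as (suc i)) k (bs (suc i)) ≤ M
      value≤M = ≤-trans (≤-reflexive (sym mᵢ₊₁≡)) (≤-trans (ms-mono i<j j≤n) mⱼ≤M)

      M<ceilingᵢ₊₁ : M < ceiling (suc i)
      M<ceilingᵢ₊₁ = <-≤-trans (M<ceiling (≤-trans z<s i<j)) (ceiling-antitone i<j j≤n)

corollary3p5 : (k : ℕ) → 2 ≤ k →
    (m n : ℕ) (as bs ms : ℕ → ℕ) →
    0 < m → m ≡ A (as n) k (bs n) + 0 → IsSandwiching k m n as bs ms →
    (x : ℕ) → 1 ≤ x → x < k →
    (d j : ℕ) → j ≤ n → (1 ≤ j → d < as j) →
    NormalForm k (iter (A d k) x (ms j)) d (iter (A d k) (x ∸ 1) (ms j)) 0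
corollary3p5 k 2≤k m n as bs ms _ _ S x 0<x x<k d j j≤n d<aⱼ =
  extend-sandwiching as bs ms ms₀
    (prefix-persists j≤n mⱼ≤M M<ceiling)
    (iterate-step d (ms j) 0<x x<k)
  where
  open Ackermann 2≤k
  open Sandwiching {as = as} {bs} {ms} S

  mⱼ≤M : ms j ≤ iter (A d k) x (ms j)
  mⱼ≤M = iter-inflationary (λ y → <⇒≤ (A-inflationary d y)) x (ms j)

  M<ceiling : 0 < j → iter (A d k) x (ms j) < ceiling j
  M<ceiling 0<j = iter-<-ceiling 0<j j≤n (d<aⱼ 0<j) x<k
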